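{- Let $\lambda$ be a nonzero real number, $k$ a positive integer, $x$ a real number (or indeterminate), and $n\ge0$. Then \[ b_{n,\lambda}^{*(k)}(x)= \sum_{l=0}^n \beta_{l,\lambda}^{*(-k)} (x)\, S_{1,\lambda}(n,l). \]
   Context: All generating functions are formal power series in $t$. Let $e_\lambda^x(t)=(1+\lambda t)^{x/\lambda}$, $e_\lambda(t)=e^1_\lambda(t)$, $e_\lambda^{ -1}(t)=(1+\lambda t)^{ -1/\lambda}$, and $\log_\lambda t=\frac{1}{\lambda}(t^\lambda-1)$. The type 2 degenerate Bernoulli polynomials of the second kind of order $k$ are defined by $\left(\frac{(1+t)-(1+t)^{ -1}}{\log_\lambda(1+t)}\right)^k(1+t)^x=\sum_{n\ge0}b_{n,\lambda}^{*(k)}(x)\frac{t^n}{n!}$. The type 2 degenerate Bernoulli polynomials of order $\alpha\in\mathbb{R}$ are defined by $\left(\frac{t}{e_\lambda(t)-e_\lambda^{ -1}(t)}\right)^\alpha e_\lambda^x(t)=\sum_{n\ge0}\beta_{n,\lambda}^{*(\alpha)}(x)\frac{t^n}{n!}$. The degenerate Stirling numbers of the first kind are given by $\frac{1}{k!}(\log_\lambda(1+t))^k=\sum_{n\ge k}S_{1,\lambda}(n,k)\frac{t^n}{n!}$. -}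

module Defs where

open import Level using (_⊔_) renaming (suc to lsuc)
open import Algebra.Bundles using (CommutativeRing)
open import Data.Nat using (ℕ; zero; suc; _∸_; _!)
open import Data.Integer using (ℤ; +_; -[1+_])
open import Data.List using (List; []; _∷_)
open import Relation.Nullary using (¬_)

-- A field of characteristic zero (the stdlib has no Field bundle).
-- The real numbers are an instance; the paper's identity is stated for
-- real λ, x, which is covered by taking F = ℝ.

fromℕ : ∀ {c ℓ} (R : CommutativeRing c ℓ) → ℕ → CommutativeRing.Carrier R
fromℕ R zero    = CommutativeRing.0# R
fromℕ R (suc n) = CommutativeRing._+_ R (CommutativeRing.1# R) (fromℕ R n)

record CharZeroField c ℓ : Set (lsuc (c ⊔ ℓ)) where
  field
    commutativeRing : CommutativeRing c ℓ
  open CommutativeRing commutativeRing public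
  field
    _⁻¹      : Carrier → Carrier
    ⁻¹-inverse : ∀ x → ¬ (x ≈ 0#) → x * (x ⁻¹) ≈ 1#
    0≉1      : ¬ (0# ≈ 1#)
    charZero : ∀ n → ¬ (fromℕ commutativeRing (suc n) ≈ 0#)

-- Formal power series in t over F, as coefficient sequences:
-- a series f stands for  Σ_{n ≥ 0} f n · t^n.

module FPS {c ℓ} (F : CharZeroField c ℓ) where
  open CharZeroField F hiding (zero)

  ι : ℕ → Carrier
  ι = fromℕ commutativeRing

  Series : Set c
  Series = ℕ → Carrier

  sumTo : (ℕ → Carrier) → ℕ → Carrier
  sumTo f zero    = f zero
  sumTo f (suc n) = sumTo f n + f (suc n)

  const : Carrier → Series
  const a zero    = a
  const a (suc n) = 0#

  one : Series
  one = const 1#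

  T : Series
  T zero          = 0#
  T (suc zero)    = 1#
  T (suc (suc n)) = 0#

  _⊕_ : Series → Series → Series
  (f ⊕ g) n = f n + g n

  _⊖_ : Series → Series → Series
  (f ⊖ g) n = f n - g n

  _·_ : Carrier → Series → Series
  (a · f) n = a * f n

  _⊛_ : Series → Series → Series
  (f ⊛ g) n = sumTo (λ i → f i * g (n ∸ i)) n

  _^ₛ_ : Series → ℕ → Series
  f ^ₛ zero  = one
  f ^ₛ suc k = f ⊛ (f ^ₛ k)

  -- multiplicative inverse of a series with invertible constant term:
  -- c₀ = f₀⁻¹,  c_{n+1} = - f₀⁻¹ · Σ_{j=0}^{n} f_{n+1-j} c_j.
  -- invRev f n is the list  c_n ∷ c_{n-1} ∷ … ∷ c_0 .
  private
    dot : Series → ℕ → List Carrier → Carrier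
    dot f i []       = 0#
    dot f i (x ∷ xs) = f (suc i) * x + dot f (suc i) xs

    hd : List Carrier → Carrier
    hd []      = 0#
    hd (x ∷ _) = x

  invRev : Series → ℕ → List Carrier
  invRev f zero    = (f zero) ⁻¹ ∷ []
  invRev f (suc n) = (- ((f zero) ⁻¹ * dot f zero cs)) ∷ cs
    where cs = invRev f n

  inv : Series → Series
  inv f n = hd (invRev f n)

  _^ᶻ_ : Series → ℤ → Series
  f ^ᶻ (+ k)     = f ^ₛ k
  f ^ᶻ -[1+ k ] = inv f ^ₛ suc k

  -- f / t  (coefficient shift), and the quotient f/g of two series
  -- with zero constant term:  f/g = (f/t) · (g/t)⁻¹
  shift : Series → Series
  shift f n = f (suc n)

  _÷_ : Series → Series → Series
  f ÷ g = shift f ⊛ inv (shift g)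

  falling : Carrier → ℕ → Carrier
  falling a zero    = 1#
  falling a (suc n) = falling a n * (a - ι n)

  binom : Carrier → ℕ → Carrier
  binom a n = falling a n * (ι (n !)) ⁻¹

  _^ᶠ_ : Carrier → ℕ → Carrier
  b ^ᶠ zero  = 1#
  b ^ᶠ suc n = b * (b ^ᶠ n)

  -- (1 + b t)^a  =  Σ_n binom(a,n) b^n t^n   (binomial series, a ∈ F)
  onePlusPow : Carrier → Carrier → Series
  onePlusPow b a n = binom a n * (b ^ᶠ n)

  1+t : Series
  1+t = one ⊕ T

  eλ^ : Carrier → Carrier → Series
  eλ^ lam x = onePlusPow lam (x * lam ⁻¹)

  eλ : Carrier → Series
  eλ lam = eλ^ lam 1#

  eλinv : Carrier → Series
  eλinv lam = onePlusPow lam (- (lam ⁻¹))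

  logλ1+t : Carrier → Series
  logλ1+t lam = (lam ⁻¹) · (onePlusPow 1# lam ⊖ one)

  -- coefficient of t^n/n!
  egf : Series → ℕ → Carrier
  egf f n = ι (n !) * f n

  bStarSeries : Carrier → ℕ → Carrier → Series
  bStarSeries lam k x =
    ((((1+t) ⊖ onePlusPow 1# (- 1#)) ÷ logλ1+t lam) ^ₛ k) ⊛ onePlusPow 1# x

  bStar : Carrier → ℕ → Carrier → ℕ → Carrier
  bStar lam k x n = egf (bStarSeries lam k x) n

  βStarSeries : Carrier → ℤ → Carrier → Series
  βStarSeries lam α x = ((T ÷ (eλ lam ⊖ eλinv lam)) ^ᶻ α) ⊛ eλ^ lam x

  βStar : Carrier → ℤ → Carrier → ℕ → Carrier
  βStar lam α x n = egf (βStarSeries lam α x) n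

  S1 : Carrier → ℕ → ℕ → Carrier
  S1 lam n k = egf (((ι (k !)) ⁻¹) · (logλ1+t lam ^ₛ k)) n

{-# OPTIONS --safe #-}
-- Substituting t ↦ L = log_λ(1 + t) into e_λ^x(t) = (1 + λt)^{x/λ} gives (1 + t)^x, because
-- 1 + λL = (1 + t)^λ and both sides solve (1 + t) g′ = x g with g(0) = 1. Hence the substitution
-- maps e_λ(t) − e_λ^{-1}(t) to (1 + t) − (1 + t)^{-1} and t to L, so it maps the generating
-- function (t / (e_λ(t) − e_λ^{-1}(t)))^{-k} e_λ^x(t) of β^{*(-k)} to the generating function
-- of b^{*(k)}. Reading off the coefficient of t^n / n! of Σ_l β_l L^l / l! then gives the sum
-- with S_{1,λ}(n, l) = n! [t^n] L^l / l!.
module Submission where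

open import Defs
open import Level using (Level; 0ℓ)
open import Data.Nat as ℕ using (ℕ; zero; suc; _∸_; _≤_; _<_; z≤n; s≤s; _!)
import Data.Nat.Properties as ℕₚ
open import Data.Integer using (+_) renaming (-_ to negℤ)
open import Data.Product using (_×_; _,_)
open import Data.Maybe using (Maybe; just; nothing)
open import Data.List using (List)
open import Relation.Nullary using (¬_; yes; no)
open import Function using (_∘_)
open import Relation.Binary.PropositionalEquality as ≡ using (_≡_)
open import Algebra.Bundles using (RawRing)
import Algebra.Solver.Ring.AlmostCommutativeRing as ACR

module _ {c ℓ} (F : CharZeroField c ℓ) where
  open CharZeroField F hiding (zero)
  open FPS F
  open import Relation.Binary.Reasoning.Setoid setoid
  open import Algebra.Properties.Ring ring
    using (-0#≈0#; -‿involutive; -‿+-comm; ⁻¹-anti-homo‿-; -‿distribˡ-*;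
           x[y-z]≈xy-xz; [y-z]x≈yx-zx)
  open import Algebra.Properties.CommutativeSemigroup +-commutativeSemigroup using (interchange)
  open import Algebra.Properties.Semiring.Mult semiring renaming (_×_ to _×ₘ_)
    using (×-homo-+; ×1-homo-*)

  x-0≈x : ∀ x → x - 0# ≈ x
  x-0≈x x = trans (+-congˡ -0#≈0#) (+-identityʳ x)

  -‿interchange : ∀ a b c d → (a + c) - (b + d) ≈ (a - b) + (c - d)
  -‿interchange a b c d = trans (+-congˡ (sym (-‿+-comm b d))) (interchange a c (- b) (- d))

  -‿cross : ∀ {a b c d} → a + d ≈ b + c → a - b ≈ c - d
  -‿cross {a} {b} {c} {d} a+d≈b+c = begin
    a - b                 ≈⟨ sym (trans (-‿interchange a b d d) (trans (+-congˡ (-‿inverseʳ d)) (+-identityʳ _))) ⟩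
    (a + d) - (b + d)     ≈⟨ +-congʳ a+d≈b+c ⟩
    (b + c) - (b + d)     ≈⟨ -‿interchange b b c d ⟩
    (b - b) + (c - d)     ≈⟨ +-congʳ (-‿inverseʳ b) ⟩
    0# + (c - d)          ≈⟨ +-identityˡ _ ⟩
    c - d                 ∎

  ι≡×1# : ∀ n → ι n ≡ n ×ₘ 1#
  ι≡×1# zero    = ≡.refl
  ι≡×1# (suc n) = ≡.cong (λ x → 1# + x) (ι≡×1# n)

  ι-+ : ∀ m n → ι (m ℕ.+ n) ≈ ι m + ι n
  ι-+ m n rewrite ι≡×1# (m ℕ.+ n) | ι≡×1# m | ι≡×1# n = ×-homo-+ 1# m n

  ι-* : ∀ m n → ι (m ℕ.* n) ≈ ι m * ι n
  ι-* m n rewrite ι≡×1# (m ℕ.* n) | ι≡×1# m | ι≡×1# n = ×1-homo-* m n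

  -- Coefficients for the ring solver: (a , b) stands for the integer a − b.
  ℕ²-rawRing : RawRing 0ℓ 0ℓ
  ℕ²-rawRing = record
    { Carrier = ℕ × ℕ
    ; _≈_ = _≡_
    ; _+_ = λ { (a , b) (c , d) → (a ℕ.+ c , b ℕ.+ d) }
    ; _*_ = λ { (a , b) (c , d) → (a ℕ.* c ℕ.+ b ℕ.* d , a ℕ.* d ℕ.+ b ℕ.* c) }
    ; -_ = λ { (a , b) → (b , a) }
    ; 0# = (0 , 0)
    ; 1# = (1 , 0)
    }

  ⟦_⟧ℕ² : ℕ × ℕ → Carrier
  ⟦ a , b ⟧ℕ² = ι a - ι b

  ⟦⟧ℕ²-homomorphism : ℕ²-rawRing ACR.-Raw-AlmostCommutative⟶ ACR.fromCommutativeRing commutativeRing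
  ⟦⟧ℕ²-homomorphism = record
    { ⟦_⟧ = ⟦_⟧ℕ²
    ; +-homo = λ { (a , b) (c , d) →
        trans (+-cong (ι-+ a c) (-‿cong (ι-+ b d))) (-‿interchange (ι a) (ι b) (ι c) (ι d)) }
    ; *-homo = λ { (a , b) (c , d) → *-homo a b c d }
    ; -‿homo = λ { (a , b) → sym (⁻¹-anti-homo‿- (ι a) (ι b)) }
    ; 0-homo = -‿inverseʳ 0#
    ; 1-homo = trans (x-0≈x _) (+-identityʳ 1#)
    }
    where
    *-homo : ∀ a b c d → ⟦ a ℕ.* c ℕ.+ b ℕ.* d , a ℕ.* d ℕ.+ b ℕ.* c ⟧ℕ² ≈ ⟦ a , b ⟧ℕ² * ⟦ c , d ⟧ℕ²
    *-homo a b c d = begin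
      ι (a ℕ.* c ℕ.+ b ℕ.* d) - ι (a ℕ.* d ℕ.+ b ℕ.* c)
        ≈⟨ +-cong (ιac+ιbd a c b d) (-‿cong (ιac+ιbd a d b c)) ⟩
      (ι a * ι c + ι b * ι d) - (ι a * ι d + ι b * ι c)
        ≈⟨ -‿interchange _ _ _ _ ⟩
      (ι a * ι c - ι a * ι d) + (ι b * ι d - ι b * ι c)
        ≈⟨ +-congˡ (sym (⁻¹-anti-homo‿- _ _)) ⟩
      (ι a * ι c - ι a * ι d) - (ι b * ι c - ι b * ι d)
        ≈⟨ sym (+-cong (x[y-z]≈xy-xz _ _ _) (-‿cong (x[y-z]≈xy-xz _ _ _))) ⟩
      ι a * (ι c - ι d) - ι b * (ι c - ι d)
        ≈⟨ sym ([y-z]x≈yx-zx _ _ _) ⟩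
      (ι a - ι b) * (ι c - ι d) ∎
      where
      ιac+ιbd : ∀ a c b d → ι (a ℕ.* c ℕ.+ b ℕ.* d) ≈ ι a * ι c + ι b * ι d
      ιac+ιbd a c b d = trans (ι-+ (a ℕ.* c) (b ℕ.* d)) (+-cong (ι-* a c) (ι-* b d))

  ⟦⟧ℕ²-equal? : ∀ x y → Maybe (⟦ x ⟧ℕ² ≈ ⟦ y ⟧ℕ²)
  ⟦⟧ℕ²-equal? (a , b) (c , d) with a ℕ.+ d ℕₚ.≟ b ℕ.+ c
  ... | yes a+d≡b+c = just (-‿cross (trans (sym (ι-+ a d)) (trans (reflexive (≡.cong ι a+d≡b+c)) (ι-+ b c))))
  ... | no _        = nothing

  open import Algebra.Solver.Ring ℕ²-rawRing (ACR.fromCommutativeRing commutativeRing)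
    ⟦⟧ℕ²-homomorphism ⟦⟧ℕ²-equal?
    using (solve; _:+_; _:*_; :-_; _:-_; _:=_)

  *-cancelˡ : ∀ {a b b′} → ¬ (a ≈ 0#) → a * b ≈ a * b′ → b ≈ b′
  *-cancelˡ {a} {b} {b′} a≉0 ab≈ab′ = begin
    b               ≈⟨ unfold b ⟩
    a ⁻¹ * (a * b)  ≈⟨ *-congˡ ab≈ab′ ⟩
    a ⁻¹ * (a * b′) ≈⟨ sym (unfold b′) ⟩
    b′              ∎
    where
    unfold : ∀ y → y ≈ a ⁻¹ * (a * y)
    unfold y = begin
      y                  ≈⟨ sym (*-identityˡ y) ⟩
      1# * y             ≈⟨ *-congʳ (sym (⁻¹-inverse a a≉0)) ⟩
      (a * a ⁻¹) * y     ≈⟨ solve 3 (λ a a⁻¹ y → (a :* a⁻¹) :* y := a⁻¹ :* (a :* y)) refl a (a ⁻¹) y ⟩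
      a ⁻¹ * (a * y)     ∎

  ⁻¹-unique : ∀ {a b} → ¬ (a ≈ 0#) → a * b ≈ 1# → b ≈ a ⁻¹
  ⁻¹-unique {a} a≉0 ab≈1 = *-cancelˡ a≉0 (trans ab≈1 (sym (⁻¹-inverse a a≉0)))

  ⁻¹-inverseˡ : ∀ a → ¬ (a ≈ 0#) → a ⁻¹ * a ≈ 1#
  ⁻¹-inverseˡ a a≉0 = trans (*-comm _ _) (⁻¹-inverse a a≉0)

  ⁻¹-nonzero : ∀ {a} → ¬ (a ≈ 0#) → ¬ (a ⁻¹ ≈ 0#)
  ⁻¹-nonzero {a} a≉0 a⁻¹≈0 = 0≉1 (begin
    0#         ≈⟨ sym (zeroʳ a) ⟩
    a * 0#     ≈⟨ *-congˡ (sym a⁻¹≈0) ⟩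
    a * a ⁻¹   ≈⟨ ⁻¹-inverse a a≉0 ⟩
    1#         ∎)

  ι1≈1 : ι 1 ≈ 1#
  ι1≈1 = +-identityʳ 1#

  ι≉0 : ∀ n → .{{ℕ.NonZero n}} → ¬ (ι n ≈ 0#)
  ι≉0 (suc n) = charZero n

  ι[n!]≉0 : ∀ n → ¬ (ι (n !) ≈ 0#)
  ι[n!]≉0 n = ι≉0 (n !) {{n ℕₚ.!≢0}}

  -- Finite sums

  sumTo-cong : ∀ {f g} → (∀ i → f i ≈ g i) → ∀ n → sumTo f n ≈ sumTo g n
  sumTo-cong f≈g zero    = f≈g zero
  sumTo-cong f≈g (suc n) = +-cong (sumTo-cong f≈g n) (f≈g (suc n))

  sumTo-cong-≤ : ∀ {f g} n → (∀ i → i ≤ n → f i ≈ g i) → sumTo f n ≈ sumTo g n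
  sumTo-cong-≤ zero    f≈g = f≈g zero z≤n
  sumTo-cong-≤ (suc n) f≈g =
    +-cong (sumTo-cong-≤ n (λ i i≤n → f≈g i (ℕₚ.m≤n⇒m≤1+n i≤n))) (f≈g (suc n) ℕₚ.≤-refl)

  sumTo-zero : ∀ f n → (∀ i → i ≤ n → f i ≈ 0#) → sumTo f n ≈ 0#
  sumTo-zero f zero    f≈0 = f≈0 zero z≤n
  sumTo-zero f (suc n) f≈0 =
    trans (+-cong (sumTo-zero f n (λ i i≤n → f≈0 i (ℕₚ.m≤n⇒m≤1+n i≤n))) (f≈0 (suc n) ℕₚ.≤-refl))
          (+-identityˡ _)

  sumTo-+ : ∀ f g n → sumTo (λ i → f i + g i) n ≈ sumTo f n + sumTo g n
  sumTo-+ f g zero    = refl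
  sumTo-+ f g (suc n) = trans (+-congʳ (sumTo-+ f g n)) (interchange _ _ _ _)

  *-sumToˡ : ∀ a f n → a * sumTo f n ≈ sumTo (λ i → a * f i) n
  *-sumToˡ a f zero    = refl
  *-sumToˡ a f (suc n) = trans (distribˡ a _ _) (+-congʳ (*-sumToˡ a f n))

  *-sumToʳ : ∀ a f n → sumTo f n * a ≈ sumTo (λ i → f i * a) n
  *-sumToʳ a f n = trans (*-comm _ a) (trans (*-sumToˡ a f n) (sumTo-cong (λ i → *-comm a (f i)) n))

  -‿sumTo : ∀ f n → - sumTo f n ≈ sumTo (λ i → - f i) n
  -‿sumTo f zero    = refl
  -‿sumTo f (suc n) = trans (sym (-‿+-comm _ _)) (+-congʳ (-‿sumTo f n))

  sumTo-suc : ∀ f n → sumTo f (suc n) ≈ f zero + sumTo (λ i → f (suc i)) n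
  sumTo-suc f zero    = refl
  sumTo-suc f (suc n) = trans (+-congʳ (sumTo-suc f n)) (+-assoc _ _ _)

  sumTo-reverse : ∀ f n → sumTo f n ≈ sumTo (λ i → f (n ∸ i)) n
  sumTo-reverse f zero    = refl
  sumTo-reverse f (suc n) = begin
    sumTo f n + f (suc n)                  ≈⟨ +-comm _ _ ⟩
    f (suc n) + sumTo f n                  ≈⟨ +-congˡ (sumTo-reverse f n) ⟩
    f (suc n) + sumTo (λ i → f (n ∸ i)) n  ≈⟨ sym (sumTo-suc (λ i → f (suc n ∸ i)) n) ⟩
    sumTo (λ i → f (suc n ∸ i)) (suc n)    ∎

  sumTo-swap : ∀ (G : ℕ → ℕ → Carrier) n m →
               sumTo (λ i → sumTo (G i) m) n ≈ sumTo (λ j → sumTo (λ i → G i j) n) m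
  sumTo-swap G zero    m = refl
  sumTo-swap G (suc n) m = trans (+-congʳ (sumTo-swap G n m)) (sym (sumTo-+ _ _ m))

  sumTo-extend : ∀ f {n m} → n ≤ m → (∀ i → n < i → f i ≈ 0#) → sumTo f n ≈ sumTo f m
  sumTo-extend f {n} {m} n≤m f≈0 with m ∸ n | ℕₚ.m∸n+n≡m n≤m
  ... | d | ≡.refl = go d
    where
    go : ∀ d → sumTo f n ≈ sumTo f (d ℕ.+ n)
    go zero    = refl
    go (suc d) = begin
      sumTo f n                            ≈⟨ go d ⟩
      sumTo f (d ℕ.+ n)                    ≈⟨ sym (+-identityʳ _) ⟩
      sumTo f (d ℕ.+ n) + 0#               ≈⟨ +-congˡ (sym (f≈0 _ (s≤s (ℕₚ.m≤n+m n d)))) ⟩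
      sumTo f (d ℕ.+ n) + f (suc d ℕ.+ n)  ∎

  sumTo-triangle : ∀ (G : ℕ → ℕ → Carrier) n →
    sumTo (λ l → sumTo (λ i → G i l) l) n ≈ sumTo (λ i → sumTo (λ j → G i (i ℕ.+ j)) (n ∸ i)) n
  sumTo-triangle G zero    = refl
  sumTo-triangle G (suc n) = begin
    sumTo (λ l → sumTo (λ i → G i l) l) n + sumTo (λ i → G i (suc n)) (suc n)
      ≈⟨ +-congʳ (sumTo-triangle G n) ⟩
    sumTo (row n) n + (sumTo (λ i → G i (suc n)) n + G (suc n) (suc n))
      ≈⟨ sym (+-assoc _ _ _) ⟩
    (sumTo (row n) n + sumTo (λ i → G i (suc n)) n) + G (suc n) (suc n)
      ≈⟨ +-cong (sym (sumTo-+ _ _ n)) (row-last n) ⟩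
    sumTo (λ i → row n i + G i (suc n)) n + row (suc n) (suc n)
      ≈⟨ +-congʳ (sumTo-cong-≤ n row-suc) ⟩
    sumTo (row (suc n)) n + row (suc n) (suc n) ∎
    where
    row : ℕ → ℕ → Carrier
    row n i = sumTo (λ j → G i (i ℕ.+ j)) (n ∸ i)

    row-last : ∀ n → G (suc n) (suc n) ≈ row (suc n) (suc n)
    row-last n rewrite ℕₚ.n∸n≡0 n = reflexive (≡.cong (G (suc n)) (≡.sym (ℕₚ.+-identityʳ (suc n))))

    row-suc : ∀ {n} i → i ≤ n → row n i + G i (suc n) ≈ row (suc n) i
    row-suc {n} i i≤n rewrite ℕₚ.+-∸-assoc 1 i≤n =
      +-congˡ (reflexive (≡.cong (G i) (≡.sym i+[1+n∸i]≡1+n)))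
      where
      i+[1+n∸i]≡1+n : i ℕ.+ suc (n ∸ i) ≡ suc n
      i+[1+n∸i]≡1+n = ≡.trans (ℕₚ.+-suc i (n ∸ i)) (≡.cong suc (ℕₚ.m+[n∸m]≡n i≤n))

  -- The ring of formal power series

  infix 4 _≋_
  record _≋_ (f g : Series) : Set ℓ where
    constructor coeffwise
    field coeff : ∀ n → f n ≈ g n
  open _≋_ public

  ≋-refl : ∀ {f} → f ≋ f
  ≋-refl = coeffwise (λ n → refl)

  ≋-sym : ∀ {f g} → f ≋ g → g ≋ f
  ≋-sym f≋g = coeffwise (λ n → sym (coeff f≋g n))

  ≋-trans : ∀ {f g h} → f ≋ g → g ≋ h → f ≋ h
  ≋-trans f≋g g≋h = coeffwise (λ n → trans (coeff f≋g n) (coeff g≋h n))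

  infixr 2 _≋⟨_⟩_
  _≋⟨_⟩_ : ∀ f {g h} → f ≋ g → g ≋ h → f ≋ h
  f ≋⟨ f≋g ⟩ g≋h = ≋-trans f≋g g≋h

  infix 3 _∎≋
  _∎≋ : ∀ f → f ≋ f
  f ∎≋ = ≋-refl

  ⊕-cong : ∀ {f f′ g g′} → f ≋ f′ → g ≋ g′ → f ⊕ g ≋ f′ ⊕ g′
  ⊕-cong f≋f′ g≋g′ = coeffwise (λ n → +-cong (coeff f≋f′ n) (coeff g≋g′ n))

  ⊖-cong : ∀ {f f′ g g′} → f ≋ f′ → g ≋ g′ → f ⊖ g ≋ f′ ⊖ g′
  ⊖-cong f≋f′ g≋g′ = coeffwise (λ n → +-cong (coeff f≋f′ n) (-‿cong (coeff g≋g′ n)))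

  ·-cong : ∀ {a a′ f f′} → a ≈ a′ → f ≋ f′ → a · f ≋ a′ · f′
  ·-cong a≈a′ f≋f′ = coeffwise (λ n → *-cong a≈a′ (coeff f≋f′ n))

  ⊛-cong : ∀ {f f′ g g′} → f ≋ f′ → g ≋ g′ → f ⊛ g ≋ f′ ⊛ g′
  ⊛-cong f≋f′ g≋g′ = coeffwise λ n → sumTo-cong (λ i → *-cong (coeff f≋f′ i) (coeff g≋g′ (n ∸ i))) n

  ⊛-congˡ : ∀ f {g g′} → g ≋ g′ → f ⊛ g ≋ f ⊛ g′
  ⊛-congˡ f = ⊛-cong (≋-refl {f})

  ⊛-congʳ : ∀ g {f f′} → f ≋ f′ → f ⊛ g ≋ f′ ⊛ g
  ⊛-congʳ g f≋f′ = ⊛-cong f≋f′ (≋-refl {g})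

  ⊛-comm : ∀ f g → f ⊛ g ≋ g ⊛ f
  ⊛-comm f g = coeffwise λ n → begin
    sumTo (λ i → f i * g (n ∸ i)) n                ≈⟨ sumTo-reverse _ n ⟩
    sumTo (λ i → f (n ∸ i) * g (n ∸ (n ∸ i))) n    ≈⟨ sumTo-cong-≤ n (λ i i≤n → trans (*-comm _ _)
                                                        (*-congʳ (reflexive (≡.cong g (ℕₚ.m∸[m∸n]≡n i≤n))))) ⟩
    sumTo (λ i → g i * f (n ∸ i)) n                ∎

  ⊛-assoc : ∀ f g h → (f ⊛ g) ⊛ h ≋ f ⊛ (g ⊛ h)
  ⊛-assoc f g h = coeffwise λ n → begin
    sumTo (λ l → sumTo (λ i → f i * g (l ∸ i)) l * h (n ∸ l)) n
      ≈⟨ sumTo-cong (λ l → *-sumToʳ _ _ l) n ⟩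
    sumTo (λ l → sumTo (λ i → f i * g (l ∸ i) * h (n ∸ l)) l) n
      ≈⟨ sumTo-triangle (λ i l → f i * g (l ∸ i) * h (n ∸ l)) n ⟩
    sumTo (λ i → sumTo (λ j → f i * g (i ℕ.+ j ∸ i) * h (n ∸ (i ℕ.+ j))) (n ∸ i)) n
      ≈⟨ sumTo-cong (λ i → sumTo-cong (reindex n i) (n ∸ i)) n ⟩
    sumTo (λ i → sumTo (λ j → f i * (g j * h (n ∸ i ∸ j))) (n ∸ i)) n
      ≈⟨ sumTo-cong (λ i → sym (*-sumToˡ _ _ (n ∸ i))) n ⟩
    sumTo (λ i → f i * sumTo (λ j → g j * h (n ∸ i ∸ j)) (n ∸ i)) n ∎
    where
    reindex : ∀ n i j → f i * g (i ℕ.+ j ∸ i) * h (n ∸ (i ℕ.+ j)) ≈ f i * (g j * h (n ∸ i ∸ j))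
    reindex n i j rewrite ℕₚ.m+n∸m≡n i j | ℕₚ.∸-+-assoc n i j = *-assoc _ _ _

  ⊛-swap : ∀ f g h → f ⊛ (g ⊛ h) ≋ g ⊛ (f ⊛ h)
  ⊛-swap f g h =
    f ⊛ (g ⊛ h)   ≋⟨ ≋-sym (⊛-assoc f g h) ⟩
    (f ⊛ g) ⊛ h   ≋⟨ ⊛-congʳ h (⊛-comm f g) ⟩
    (g ⊛ f) ⊛ h   ≋⟨ ⊛-assoc g f h ⟩
    g ⊛ (f ⊛ h)   ∎≋

  ⊛-distribʳ : ∀ h f g → (f ⊕ g) ⊛ h ≋ (f ⊛ h) ⊕ (g ⊛ h)
  ⊛-distribʳ h f g = coeffwise λ n → trans (sumTo-cong (λ i → distribʳ _ _ _) n) (sumTo-+ _ _ n)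

  ⊛-·ˡ : ∀ a f g → (a · f) ⊛ g ≋ a · (f ⊛ g)
  ⊛-·ˡ a f g = coeffwise λ n → trans (sumTo-cong (λ i → *-assoc _ _ _) n) (sym (*-sumToˡ a _ n))

  ⊛-·ʳ : ∀ a f g → f ⊛ (a · g) ≋ a · (f ⊛ g)
  ⊛-·ʳ a f g = coeffwise λ n →
    trans (sumTo-cong (λ i → solve 3 (λ a x y → x :* (a :* y) := a :* (x :* y)) refl a (f i) (g (n ∸ i))) n)
          (sym (*-sumToˡ a _ n))

  sumTo-one : ∀ (h : ℕ → Carrier) n → sumTo (λ i → one i * h i) n ≈ h zero
  sumTo-one h zero    = *-identityˡ _
  sumTo-one h (suc n) = trans (+-cong (sumTo-one h n) (zeroˡ _)) (+-identityʳ _)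

  ⊛-identityˡ : ∀ f → one ⊛ f ≋ f
  ⊛-identityˡ f = coeffwise λ n → sumTo-one (λ i → f (n ∸ i)) n

  ⊛-identityʳ : ∀ f → f ⊛ one ≋ f
  ⊛-identityʳ f = ≋-trans (⊛-comm f one) (⊛-identityˡ f)

  shift-T : shift T ≋ one
  shift-T = coeffwise λ { zero → refl ; (suc n) → refl }

  sumTo-shift-T : ∀ (h : ℕ → Carrier) n → sumTo (λ i → T (suc i) * h i) n ≈ h zero
  sumTo-shift-T h n = trans (sumTo-cong (λ i → *-congʳ (coeff shift-T i)) n) (sumTo-one h n)

  T⊛-zero : ∀ f → (T ⊛ f) zero ≈ 0#
  T⊛-zero f = zeroˡ _

  T⊛-suc : ∀ f n → (T ⊛ f) (suc n) ≈ f n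
  T⊛-suc f n = begin
    (T ⊛ f) (suc n)                                    ≈⟨ sumTo-suc _ n ⟩
    0# * f (suc n) + sumTo (λ i → T (suc i) * f (n ∸ i)) n ≈⟨ +-cong (zeroˡ _) (sumTo-shift-T _ n) ⟩
    0# + f n                                           ≈⟨ +-identityˡ _ ⟩
    f n                                                ∎

  T⊛shift : ∀ f → f zero ≈ 0# → T ⊛ shift f ≋ f
  T⊛shift f f₀≈0 = coeffwise λ { zero → trans (T⊛-zero (shift f)) (sym f₀≈0) ; (suc n) → T⊛-suc (shift f) n }

  T⊛-cancel : ∀ {f g} → T ⊛ f ≋ T ⊛ g → f ≋ g
  T⊛-cancel {f} {g} Tf≋Tg = coeffwise λ n → trans (sym (T⊛-suc f n)) (trans (coeff Tf≋Tg (suc n)) (T⊛-suc g n))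

  ^ₛ-cong : ∀ {f g} → f ≋ g → ∀ k → f ^ₛ k ≋ g ^ₛ k
  ^ₛ-cong f≋g zero    = ≋-refl
  ^ₛ-cong f≋g (suc k) = ⊛-cong f≋g (^ₛ-cong f≋g k)

  ^ₛ-+ : ∀ f i j → f ^ₛ (i ℕ.+ j) ≋ (f ^ₛ i) ⊛ (f ^ₛ j)
  ^ₛ-+ f zero    j = ≋-sym (⊛-identityˡ (f ^ₛ j))
  ^ₛ-+ f (suc i) j = ≋-trans (⊛-congˡ f (^ₛ-+ f i j)) (≋-sym (⊛-assoc f (f ^ₛ i) (f ^ₛ j)))

  -- Inverse series

  -- The step function of invRev is private to Defs: invStep is solved to it by unification in
  -- inv-suc, whose 'with' abstracts the arguments so that the constraint is a pattern.
  mutual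
    invStep : Series → ℕ → List Carrier → Carrier
    invStep = _

    inv-suc : ∀ f n → inv f (suc n) ≡ - (f zero ⁻¹ * invStep f zero (invRev f n))
    inv-suc f n with invRev f n | zero
    ... | cs | i = ≡.refl

  invStep-invRev : ∀ f i n → invStep f i (invRev f n) ≈ sumTo (λ j → f (suc (i ℕ.+ j)) * inv f (n ∸ j)) n
  invStep-invRev f i zero    = trans (+-identityʳ _) (*-congʳ (reflexive (≡.cong (f ∘ suc) (≡.sym (ℕₚ.+-identityʳ i)))))
  invStep-invRev f i (suc n) = begin
    f (suc i) * inv f (suc n) + invStep f (suc i) (invRev f n)
      ≈⟨ +-cong (*-congʳ (at-suc (≡.sym (ℕₚ.+-identityʳ i)))) (invStep-invRev f (suc i) n) ⟩
    f (suc (i ℕ.+ 0)) * inv f (suc n) + sumTo (λ j → f (suc (suc i ℕ.+ j)) * inv f (n ∸ j)) n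
      ≈⟨ +-congˡ (sumTo-cong (λ j → *-congʳ (at-suc (≡.sym (ℕₚ.+-suc i j)))) n) ⟩
    f (suc (i ℕ.+ 0)) * inv f (suc n) + sumTo (λ j → f (suc (i ℕ.+ suc j)) * inv f (n ∸ j)) n
      ≈⟨ sym (sumTo-suc _ n) ⟩
    sumTo (λ j → f (suc (i ℕ.+ j)) * inv f (suc n ∸ j)) (suc n) ∎
    where
    at-suc : ∀ {m m′} → m ≡ m′ → f (suc m) ≈ f (suc m′)
    at-suc = reflexive ∘ ≡.cong (f ∘ suc)

  ⊛-inverseʳ : ∀ f → ¬ (f zero ≈ 0#) → f ⊛ inv f ≋ one
  ⊛-inverseʳ f f₀≉0 = coeffwise λ { zero → ⁻¹-inverse (f zero) f₀≉0 ; (suc n) → higher n }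
    where
    higher : ∀ n → (f ⊛ inv f) (suc n) ≈ 0#
    higher n = begin
      (f ⊛ inv f) (suc n)                                   ≈⟨ sumTo-suc _ n ⟩
      f zero * inv f (suc n) + S                            ≈⟨ +-congʳ (*-congˡ (reflexive (inv-suc f n))) ⟩
      f zero * - (f zero ⁻¹ * invStep f zero (invRev f n)) + S ≈⟨ +-congʳ (*-congˡ (-‿cong (*-congˡ (invStep-invRev f zero n)))) ⟩
      f zero * - (f zero ⁻¹ * S) + S                        ≈⟨ +-congʳ (solve 3 (λ a b s → a :* (:- (b :* s)) := :- ((a :* b) :* s)) refl (f zero) (f zero ⁻¹) S) ⟩
      - ((f zero * f zero ⁻¹) * S) + S                      ≈⟨ +-congʳ (-‿cong (trans (*-congʳ (⁻¹-inverse (f zero) f₀≉0)) (*-identityˡ S))) ⟩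
      - S + S                                               ≈⟨ -‿inverseˡ S ⟩
      0#                                                    ∎
      where
      S = sumTo (λ j → f (suc j) * inv f (n ∸ j)) n

  inv-unique : ∀ f g → ¬ (f zero ≈ 0#) → f ⊛ g ≋ one → g ≋ inv f
  inv-unique f g f₀≉0 fg≋1 =
    g                 ≋⟨ ≋-sym (⊛-identityˡ g) ⟩
    one ⊛ g           ≋⟨ ⊛-congʳ g (≋-sym (≋-trans (⊛-comm (inv f) f) (⊛-inverseʳ f f₀≉0))) ⟩
    (inv f ⊛ f) ⊛ g   ≋⟨ ⊛-assoc (inv f) f g ⟩
    inv f ⊛ (f ⊛ g)   ≋⟨ ⊛-congˡ (inv f) fg≋1 ⟩
    inv f ⊛ one       ≋⟨ ⊛-identityʳ (inv f) ⟩
    inv f             ∎≋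

  ÷-unique : ∀ f g h → ¬ (g 1 ≈ 0#) → shift g ⊛ h ≋ shift f → f ÷ g ≋ h
  ÷-unique f g h g₁≉0 gh≋f =
    shift f ⊛ inv (shift g)              ≋⟨ ⊛-congʳ (inv (shift g)) (≋-sym gh≋f) ⟩
    (shift g ⊛ h) ⊛ inv (shift g)        ≋⟨ ⊛-congʳ (inv (shift g)) (⊛-comm (shift g) h) ⟩
    (h ⊛ shift g) ⊛ inv (shift g)        ≋⟨ ⊛-assoc h (shift g) (inv (shift g)) ⟩
    h ⊛ (shift g ⊛ inv (shift g))        ≋⟨ ⊛-congˡ h (⊛-inverseʳ (shift g) g₁≉0) ⟩
    h ⊛ one                              ≋⟨ ⊛-identityʳ h ⟩
    h                                    ∎≋

  inv-T÷ : ∀ f → ¬ (f 1 ≈ 0#) → inv (T ÷ f) ≋ shift f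
  inv-T÷ f f₁≉0 = ≋-sym (inv-unique (T ÷ f) (shift f) [T÷f]₀≉0 (
    (shift T ⊛ inv (shift f)) ⊛ shift f ≋⟨ ⊛-congʳ (shift f) (⊛-congʳ (inv (shift f)) shift-T) ⟩
    (one ⊛ inv (shift f)) ⊛ shift f     ≋⟨ ⊛-congʳ (shift f) (⊛-identityˡ (inv (shift f))) ⟩
    inv (shift f) ⊛ shift f             ≋⟨ ⊛-comm (inv (shift f)) (shift f) ⟩
    shift f ⊛ inv (shift f)             ≋⟨ ⊛-inverseʳ (shift f) f₁≉0 ⟩
    one                                 ∎≋))
    where
    [T÷f]₀≉0 : ¬ ((T ÷ f) zero ≈ 0#)
    [T÷f]₀≉0 = ⁻¹-nonzero f₁≉0 ∘ trans (sym (*-identityˡ _))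

  -- Formal derivative

  D : Series → Series
  D f n = ι (suc n) * f (suc n)

  D-cong : ∀ {f g} → f ≋ g → D f ≋ D g
  D-cong f≋g = coeffwise λ n → *-congˡ (coeff f≋g (suc n))

  D-⊖ : ∀ f g → D (f ⊖ g) ≋ D f ⊖ D g
  D-⊖ f g = coeffwise λ n → x[y-z]≈xy-xz _ _ _

  D-· : ∀ a f → D (a · f) ≋ a · D f
  D-· a f = coeffwise λ n → solve 3 (λ u a x → u :* (a :* x) := a :* (u :* x)) refl (ι (suc n)) a (f (suc n))

  D-one : ∀ n → D one n ≈ 0#
  D-one n = zeroʳ _

  D-⊛ : ∀ f g → D (f ⊛ g) ≋ (D f ⊛ g) ⊕ (f ⊛ D g)
  D-⊛ f g = coeffwise λ n → sym (begin
    (D f ⊛ g) n + (f ⊛ D g) n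
      ≈⟨ +-cong (D-left n) (D-right n) ⟩
    sumTo (λ i → ι i * X n i) (suc n) + sumTo (λ i → ι (suc n ∸ i) * X n i) (suc n)
      ≈⟨ sym (sumTo-+ _ _ (suc n)) ⟩
    sumTo (λ i → ι i * X n i + ι (suc n ∸ i) * X n i) (suc n)
      ≈⟨ sumTo-cong-≤ (suc n) (λ i i≤ → trans (sym (distribʳ _ _ _)) (*-congʳ (ι-split i≤))) ⟩
    sumTo (λ i → ι (suc n) * X n i) (suc n)
      ≈⟨ sym (*-sumToˡ _ _ (suc n)) ⟩
    ι (suc n) * sumTo (X n) (suc n) ∎)
    where
    X : ℕ → ℕ → Carrier
    X n i = f i * g (suc n ∸ i)

    ι-split : ∀ {i m} → i ≤ m → ι i + ι (m ∸ i) ≈ ι m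
    ι-split {i} i≤m = trans (sym (ι-+ i _)) (reflexive (≡.cong ι (ℕₚ.m+[n∸m]≡n i≤m)))

    D-left : ∀ n → (D f ⊛ g) n ≈ sumTo (λ i → ι i * X n i) (suc n)
    D-left n = begin
      sumTo (λ i → (ι (suc i) * f (suc i)) * g (n ∸ i)) n    ≈⟨ sumTo-cong (λ i → *-assoc _ _ _) n ⟩
      sumTo (λ i → ι (suc i) * X n (suc i)) n                ≈⟨ sym (+-identityˡ _) ⟩
      0# + sumTo (λ i → ι (suc i) * X n (suc i)) n           ≈⟨ +-congʳ (sym (zeroˡ _)) ⟩
      0# * X n 0 + sumTo (λ i → ι (suc i) * X n (suc i)) n   ≈⟨ sym (sumTo-suc _ n) ⟩
      sumTo (λ i → ι i * X n i) (suc n)                      ∎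

    D-right : ∀ n → (f ⊛ D g) n ≈ sumTo (λ i → ι (suc n ∸ i) * X n i) (suc n)
    D-right n = begin
      sumTo (λ i → f i * (ι (suc (n ∸ i)) * g (suc (n ∸ i)))) n
        ≈⟨ sumTo-cong-≤ n (λ i i≤n → trans (solve 3 (λ a u b → a :* (u :* b) := u :* (a :* b)) refl (f i) _ _) (reflexive (≡.cong (λ m → ι m * (f i * g m)) (≡.sym (ℕₚ.+-∸-assoc 1 i≤n))))) ⟩
      sumTo (λ i → ι (suc n ∸ i) * X n i) n
        ≈⟨ sym (+-identityʳ _) ⟩
      sumTo (λ i → ι (suc n ∸ i) * X n i) n + 0#
        ≈⟨ +-congˡ (trans (sym (zeroˡ _)) (*-congʳ (reflexive (≡.cong ι (≡.sym (ℕₚ.n∸n≡0 n)))))) ⟩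
      sumTo (λ i → ι (suc n ∸ i) * X n i) (suc n) ∎

  D-^ₛ : ∀ f m → D (f ^ₛ suc m) ≋ ι (suc m) · ((f ^ₛ m) ⊛ D f)
  D-^ₛ f zero = coeffwise λ n → begin
    D (f ⊛ one) n           ≈⟨ coeff (D-cong (⊛-identityʳ f)) n ⟩
    D f n                   ≈⟨ sym (coeff (⊛-identityˡ (D f)) n) ⟩
    (one ⊛ D f) n           ≈⟨ sym (*-identityˡ _) ⟩
    1# * (one ⊛ D f) n      ≈⟨ *-congʳ (sym ι1≈1) ⟩
    ι 1 * (one ⊛ D f) n     ∎
  D-^ₛ f (suc m) =
    D (f ⊛ (f ^ₛ suc m))                                           ≋⟨ D-⊛ f (f ^ₛ suc m) ⟩
    (D f ⊛ (f ^ₛ suc m)) ⊕ (f ⊛ D (f ^ₛ suc m))                    ≋⟨ ⊕-cong (⊛-comm (D f) (f ^ₛ suc m)) (⊛-congˡ f (D-^ₛ f m)) ⟩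
    ((f ^ₛ suc m) ⊛ D f) ⊕ (f ⊛ (ι (suc m) · ((f ^ₛ m) ⊛ D f)))    ≋⟨ ⊕-cong ≋-refl (⊛-·ʳ (ι (suc m)) f ((f ^ₛ m) ⊛ D f)) ⟩
    ((f ^ₛ suc m) ⊛ D f) ⊕ (ι (suc m) · (f ⊛ ((f ^ₛ m) ⊛ D f)))    ≋⟨ ⊕-cong ≋-refl (·-cong refl (≋-sym (⊛-assoc f (f ^ₛ m) (D f)))) ⟩
    ((f ^ₛ suc m) ⊛ D f) ⊕ (ι (suc m) · ((f ^ₛ suc m) ⊛ D f))      ≋⟨ coeffwise (λ n → sym (trans (distribʳ _ _ _) (+-congʳ (*-identityˡ _)))) ⟩
    ι (suc (suc m)) · ((f ^ₛ suc m) ⊛ D f)                         ∎≋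

  -- Binomial series

  affine : Carrier → Series
  affine b = one ⊕ (b · T)

  affine⊛-zero : ∀ b g → (affine b ⊛ g) zero ≈ g zero
  affine⊛-zero b g = begin
    (affine b ⊛ g) zero                     ≈⟨ coeff (⊛-distribʳ g one (b · T)) zero ⟩
    (one ⊛ g) zero + ((b · T) ⊛ g) zero     ≈⟨ +-cong (coeff (⊛-identityˡ g) zero) (coeff (⊛-·ˡ b T g) zero) ⟩
    g zero + b * (T ⊛ g) zero               ≈⟨ +-congˡ (trans (*-congˡ (T⊛-zero g)) (zeroʳ _)) ⟩
    g zero + 0#                             ≈⟨ +-identityʳ _ ⟩
    g zero                                  ∎

  affine⊛-suc : ∀ b g n → (affine b ⊛ g) (suc n) ≈ g (suc n) + b * g n
  affine⊛-suc b g n = begin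
    (affine b ⊛ g) (suc n)                       ≈⟨ coeff (⊛-distribʳ g one (b · T)) (suc n) ⟩
    (one ⊛ g) (suc n) + ((b · T) ⊛ g) (suc n)    ≈⟨ +-cong (coeff (⊛-identityˡ g) (suc n)) (coeff (⊛-·ˡ b T g) (suc n)) ⟩
    g (suc n) + b * (T ⊛ g) (suc n)              ≈⟨ +-congˡ (*-congˡ (T⊛-suc g n)) ⟩
    g (suc n) + b * g n                          ∎

  LinearODE : Carrier → Carrier → Series → Set ℓ
  LinearODE b a g = affine b ⊛ D g ≋ a · g

  LinearRecurrence : Carrier → Carrier → Series → Set ℓ
  LinearRecurrence b a g = ∀ n → ι (suc n) * g (suc n) ≈ (a - b * ι n) * g n

  a-b*ι0≈a : ∀ a b → a - b * ι 0 ≈ a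
  a-b*ι0≈a a b = trans (+-congˡ (-‿cong (zeroʳ b))) (x-0≈x a)

  recurrence⇒ODE : ∀ {b a g} → LinearRecurrence b a g → LinearODE b a g
  recurrence⇒ODE {b} {a} {g} rec = coeffwise λ where
    zero    → trans (affine⊛-zero b (D g)) (trans (rec zero) (*-congʳ (a-b*ι0≈a a b)))
    (suc n) → begin
      (affine b ⊛ D g) (suc n)                                     ≈⟨ affine⊛-suc b (D g) n ⟩
      ι (suc (suc n)) * g (suc (suc n)) + b * (ι (suc n) * g (suc n)) ≈⟨ +-congʳ (rec (suc n)) ⟩
      (a - b * ι (suc n)) * g (suc n) + b * (ι (suc n) * g (suc n)) ≈⟨ solve 4 (λ a b x y → (a :- b :* x) :* y :+ b :* (x :* y) := a :* y) refl a b (ι (suc n)) (g (suc n)) ⟩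
      a * g (suc n)                                                ∎

  ODE⇒recurrence : ∀ {b a g} → LinearODE b a g → LinearRecurrence b a g
  ODE⇒recurrence {b} {a} {g} ode zero =
    trans (sym (affine⊛-zero b (D g))) (trans (coeff ode zero) (*-congʳ (sym (a-b*ι0≈a a b))))
  ODE⇒recurrence {b} {a} {g} ode (suc n) = begin
    X                                  ≈⟨ solve 2 (λ x y → x := (x :+ y) :- y) refl X Y ⟩
    (X + Y) - Y                        ≈⟨ +-congʳ (trans (sym (affine⊛-suc b (D g) n)) (coeff ode (suc n))) ⟩
    a * g (suc n) - Y                  ≈⟨ solve 4 (λ a b x y → a :* y :- b :* (x :* y) := (a :- b :* x) :* y) refl a b (ι (suc n)) (g (suc n)) ⟩
    (a - b * ι (suc n)) * g (suc n)    ∎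
    where
    X = ι (suc (suc n)) * g (suc (suc n))
    Y = b * (ι (suc n) * g (suc n))

  recurrence-unique : ∀ {b a g h} → LinearRecurrence b a g → LinearRecurrence b a h →
                      g zero ≈ h zero → g ≋ h
  recurrence-unique {g = g} {h} rec-g rec-h g₀≈h₀ = coeffwise go
    where
    go : ∀ n → g n ≈ h n
    go zero    = g₀≈h₀
    go (suc n) = *-cancelˡ (charZero n) (trans (rec-g n) (trans (*-congˡ (go n)) (sym (rec-h n))))

  binomial-recurrence : ∀ b a → LinearRecurrence b (a * b) (onePlusPow b a)
  binomial-recurrence b a n = begin
    u * ((Fa * A * w) * (b * B))          ≈⟨ solve 6 (λ u Fa A w b B → u :* ((Fa :* A :* w) :* (b :* B)) := (Fa :* A :* b :* B) :* (u :* w)) refl u Fa A w b B ⟩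
    (Fa * A * b * B) * (u * w)            ≈⟨ *-congˡ (ι[1+n]/[1+n]!≈1/n! n) ⟩
    (Fa * A * b * B) * ι (n !) ⁻¹         ≈⟨ solve 6 (λ Fa a x b B v → (Fa :* (a :- x) :* b :* B) :* v := (a :* b :- b :* x) :* ((Fa :* v) :* B)) refl Fa a (ι n) b B (ι (n !) ⁻¹) ⟩
    (a * b - b * ι n) * ((Fa * ι (n !) ⁻¹) * B) ∎
    where
    u = ι (suc n)
    Fa = falling a n
    A = a - ι n
    w = ι (suc n !) ⁻¹
    B = b ^ᶠ n

    ι[1+n]/[1+n]!≈1/n! : ∀ n → ι (suc n) * ι (suc n !) ⁻¹ ≈ ι (n !) ⁻¹
    ι[1+n]/[1+n]!≈1/n! n = ⁻¹-unique (ι[n!]≉0 n) (begin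
      ι (n !) * (ι (suc n) * ι (suc n !) ⁻¹)   ≈⟨ sym (*-assoc _ _ _) ⟩
      (ι (n !) * ι (suc n)) * ι (suc n !) ⁻¹   ≈⟨ *-congʳ (trans (*-comm _ _) (sym (ι-* (suc n) (n !)))) ⟩
      ι (suc n !) * ι (suc n !) ⁻¹             ≈⟨ ⁻¹-inverse _ (ι[n!]≉0 (suc n)) ⟩
      1#                                       ∎)

  binomial-ODE : ∀ b a → LinearODE b (a * b) (onePlusPow b a)
  binomial-ODE b a = recurrence⇒ODE (binomial-recurrence b a)

  binomial-zero : ∀ b a → onePlusPow b a zero ≈ 1#
  binomial-zero b a = begin
    (1# * ι 1 ⁻¹) * 1#  ≈⟨ trans (*-identityʳ _) (*-identityˡ _) ⟩
    ι 1 ⁻¹              ≈⟨ sym (⁻¹-unique (charZero 0) (trans (*-identityʳ _) ι1≈1)) ⟩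
    1#                  ∎

  binomial-one : ∀ b a → onePlusPow b a 1 ≈ a * b
  binomial-one b a = begin
    onePlusPow b a 1              ≈⟨ sym (trans (*-congʳ ι1≈1) (*-identityˡ _)) ⟩
    ι 1 * onePlusPow b a 1        ≈⟨ binomial-recurrence b a 0 ⟩
    (a * b - b * ι 0) * onePlusPow b a 0 ≈⟨ *-cong (a-b*ι0≈a (a * b) b) (binomial-zero b a) ⟩
    a * b * 1#                    ≈⟨ *-identityʳ _ ⟩
    a * b                         ∎

  falling-cong : ∀ {a a′} → a ≈ a′ → ∀ n → falling a n ≈ falling a′ n
  falling-cong a≈a′ zero    = refl
  falling-cong a≈a′ (suc n) = *-cong (falling-cong a≈a′ n) (+-congʳ a≈a′)

  binomial-cong : ∀ b {a a′} → a ≈ a′ → onePlusPow b a ≋ onePlusPow b a′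
  binomial-cong b a≈a′ = coeffwise λ n → *-congʳ (*-congʳ (falling-cong a≈a′ n))

  -- Substitution of a series without constant term

  module Composition (L : Series) (L₀≈0 : L zero ≈ 0#) where

    compose : Series → Series
    compose f n = sumTo (λ l → f l * (L ^ₛ l) n) n

    ^ₛ-vanishes-below : ∀ l n → n < l → (L ^ₛ l) n ≈ 0#
    ^ₛ-vanishes-below (suc l) n (s≤s n≤l) = sumTo-zero _ n term
      where
      term : ∀ i → i ≤ n → L i * (L ^ₛ l) (n ∸ i) ≈ 0#
      term zero    _     = trans (*-congʳ L₀≈0) (zeroˡ _)
      term (suc i) 1+i≤n = trans (*-congˡ (^ₛ-vanishes-below l (n ∸ suc i) n-1-i<l)) (zeroʳ _)
        where
        n-1-i<l : n ∸ suc i < l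
        n-1-i<l = ℕₚ.<-≤-trans (ℕₚ.∸-monoʳ-< (s≤s z≤n) 1+i≤n) n≤l

    compose-extend : ∀ f {n m} → n ≤ m → compose f n ≈ sumTo (λ l → f l * (L ^ₛ l) n) m
    compose-extend f {n} n≤m =
      sumTo-extend _ n≤m (λ l n<l → trans (*-congˡ (^ₛ-vanishes-below l n n<l)) (zeroʳ _))

    compose-cong : ∀ {f g} → f ≋ g → compose f ≋ compose g
    compose-cong f≋g = coeffwise λ n → sumTo-cong (λ l → *-congʳ (coeff f≋g l)) n

    compose-⊕ : ∀ f g → compose (f ⊕ g) ≋ compose f ⊕ compose g
    compose-⊕ f g = coeffwise λ n → trans (sumTo-cong (λ l → distribʳ _ _ _) n) (sumTo-+ _ _ n)

    compose-⊖ : ∀ f g → compose (f ⊖ g) ≋ compose f ⊖ compose g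
    compose-⊖ f g = coeffwise λ n → begin
      sumTo (λ l → (f l - g l) * (L ^ₛ l) n) n                              ≈⟨ sumTo-cong (λ l → [y-z]x≈yx-zx _ _ _) n ⟩
      sumTo (λ l → f l * (L ^ₛ l) n + - (g l * (L ^ₛ l) n)) n                ≈⟨ sumTo-+ _ _ n ⟩
      compose f n + sumTo (λ l → - (g l * (L ^ₛ l) n)) n                     ≈⟨ +-congˡ (sym (-‿sumTo _ n)) ⟩
      compose f n - compose g n                                              ∎

    compose-· : ∀ a f → compose (a · f) ≋ a · compose f
    compose-· a f = coeffwise λ n → trans (sumTo-cong (λ l → *-assoc _ _ _) n) (sym (*-sumToˡ a _ n))

    compose-one : compose one ≋ one
    compose-one = coeffwise λ n → sumTo-one (λ l → (L ^ₛ l) n) n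

    compose-T : compose T ≋ L
    compose-T = coeffwise λ where
      zero    → trans (zeroˡ _) (sym L₀≈0)
      (suc m) → begin
        compose T (suc m)                                                ≈⟨ sumTo-suc _ m ⟩
        0# * one (suc m) + sumTo (λ l → T (suc l) * (L ^ₛ suc l) (suc m)) m ≈⟨ +-cong (zeroˡ _) (sumTo-shift-T _ m) ⟩
        0# + (L ⊛ one) (suc m)                                           ≈⟨ +-identityˡ _ ⟩
        (L ⊛ one) (suc m)                                                ≈⟨ coeff (⊛-identityʳ L) (suc m) ⟩
        L (suc m)                                                        ∎

    compose-⊛ : ∀ f g → compose (f ⊛ g) ≋ compose f ⊛ compose g
    compose-⊛ f g = coeffwise λ n → trans (lhs n) (sym (rhs n))
      where
      Q : ℕ → ℕ → ℕ → Carrier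
      Q n i j = (f i * g j) * (L ^ₛ (i ℕ.+ j)) n

      lhs : ∀ n → compose (f ⊛ g) n ≈ sumTo (λ i → sumTo (Q n i) n) n
      lhs n = begin
        sumTo (λ l → sumTo (λ i → f i * g (l ∸ i)) l * (L ^ₛ l) n) n
          ≈⟨ sumTo-cong (λ l → *-sumToʳ _ _ l) n ⟩
        sumTo (λ l → sumTo (λ i → f i * g (l ∸ i) * (L ^ₛ l) n) l) n
          ≈⟨ sumTo-triangle (λ i l → f i * g (l ∸ i) * (L ^ₛ l) n) n ⟩
        sumTo (λ i → sumTo (λ j → f i * g (i ℕ.+ j ∸ i) * (L ^ₛ (i ℕ.+ j)) n) (n ∸ i)) n
          ≈⟨ sumTo-cong (λ i → sumTo-cong (λ j → *-congʳ (*-congˡ (reflexive (≡.cong g (ℕₚ.m+n∸m≡n i j))))) (n ∸ i)) n ⟩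
        sumTo (λ i → sumTo (Q n i) (n ∸ i)) n
          ≈⟨ sumTo-cong (λ i → sumTo-extend _ (ℕₚ.m∸n≤m n i) (λ j n-i<j → trans (*-congˡ (^ₛ-vanishes-below (i ℕ.+ j) n (n<i+j i j n-i<j))) (zeroʳ _))) n ⟩
        sumTo (λ i → sumTo (Q n i) n) n ∎
        where
        n<i+j : ∀ i j → n ∸ i < j → n < i ℕ.+ j
        n<i+j i j n-i<j = ℕₚ.≤-<-trans (ℕₚ.m≤n+m∸n n i) (ℕₚ.+-monoʳ-< i n-i<j)

      rhs : ∀ n → (compose f ⊛ compose g) n ≈ sumTo (λ i → sumTo (Q n i) n) n
      rhs n = begin
        sumTo (λ a → compose f a * compose g (n ∸ a)) n
          ≈⟨ sumTo-cong-≤ n (λ a a≤n → *-cong (compose-extend f a≤n) (compose-extend g (ℕₚ.m∸n≤m n a))) ⟩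
        sumTo (λ a → sumTo (λ i → f i * (L ^ₛ i) a) n * sumTo (λ j → g j * (L ^ₛ j) (n ∸ a)) n) n
          ≈⟨ sumTo-cong (λ a → trans (*-sumToʳ _ _ n) (sumTo-cong (λ i → *-sumToˡ _ _ n) n)) n ⟩
        sumTo (λ a → sumTo (λ i → sumTo (λ j → (f i * (L ^ₛ i) a) * (g j * (L ^ₛ j) (n ∸ a))) n) n) n
          ≈⟨ sumTo-swap _ n n ⟩
        sumTo (λ i → sumTo (λ a → sumTo (λ j → (f i * (L ^ₛ i) a) * (g j * (L ^ₛ j) (n ∸ a))) n) n) n
          ≈⟨ sumTo-cong (λ i → sumTo-swap _ n n) n ⟩
        sumTo (λ i → sumTo (λ j → sumTo (λ a → (f i * (L ^ₛ i) a) * (g j * (L ^ₛ j) (n ∸ a))) n) n) n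
          ≈⟨ sumTo-cong (λ i → sumTo-cong (λ j → trans (sumTo-cong (λ a → rearrange (f i) _ (g j) _) n) (sym (*-sumToˡ _ _ n))) n) n ⟩
        sumTo (λ i → sumTo (λ j → (f i * g j) * ((L ^ₛ i) ⊛ (L ^ₛ j)) n) n) n
          ≈⟨ sumTo-cong (λ i → sumTo-cong (λ j → *-congˡ (sym (coeff (^ₛ-+ L i j) n))) n) n ⟩
        sumTo (λ i → sumTo (Q n i) n) n ∎
        where
        rearrange : ∀ x u y v → (x * u) * (y * v) ≈ (x * y) * (u * v)
        rearrange = solve 4 (λ x u y v → (x :* u) :* (y :* v) := (x :* y) :* (u :* v)) refl

    compose-^ₛ : ∀ f k → compose (f ^ₛ k) ≋ compose f ^ₛ k
    compose-^ₛ f zero    = compose-one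
    compose-^ₛ f (suc k) = ≋-trans (compose-⊛ f (f ^ₛ k)) (⊛-congˡ (compose f) (compose-^ₛ f k))

    chain-rule : ∀ f → D (compose f) ≋ compose (D f) ⊛ D L
    chain-rule f = coeffwise λ n → trans (lhs n) (sym (rhs n))
      where
      R : ℕ → Carrier
      R n = sumTo (λ m → D f m * ((L ^ₛ m) ⊛ D L) n) n

      lhs : ∀ n → D (compose f) n ≈ R n
      lhs n = begin
        ι (suc n) * sumTo (λ l → f l * (L ^ₛ l) (suc n)) (suc n)
          ≈⟨ trans (*-sumToˡ _ _ (suc n)) (sumTo-cong (λ l → solve 3 (λ u x y → u :* (x :* y) := x :* (u :* y)) refl (ι (suc n)) (f l) _) (suc n)) ⟩
        sumTo (λ l → f l * D (L ^ₛ l) n) (suc n)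
          ≈⟨ sumTo-suc _ n ⟩
        f zero * D one n + sumTo (λ m → f (suc m) * D (L ^ₛ suc m) n) n
          ≈⟨ +-cong (trans (*-congˡ (D-one n)) (zeroʳ _)) (sumTo-cong (λ m → *-congˡ (coeff (D-^ₛ L m) n)) n) ⟩
        0# + sumTo (λ m → f (suc m) * (ι (suc m) * ((L ^ₛ m) ⊛ D L) n)) n
          ≈⟨ trans (+-identityˡ _) (sumTo-cong (λ m → solve 3 (λ x u y → x :* (u :* y) := (u :* x) :* y) refl (f (suc m)) (ι (suc m)) _) n) ⟩
        R n ∎

      rhs : ∀ n → (compose (D f) ⊛ D L) n ≈ R n
      rhs n = begin
        sumTo (λ a → compose (D f) a * D L (n ∸ a)) n
          ≈⟨ sumTo-cong-≤ n (λ a a≤n → *-congʳ (compose-extend (D f) a≤n)) ⟩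
        sumTo (λ a → sumTo (λ m → D f m * (L ^ₛ m) a) n * D L (n ∸ a)) n
          ≈⟨ sumTo-cong (λ a → trans (*-sumToʳ _ _ n) (sumTo-cong (λ m → *-assoc _ _ _) n)) n ⟩
        sumTo (λ a → sumTo (λ m → D f m * ((L ^ₛ m) a * D L (n ∸ a))) n) n
          ≈⟨ sumTo-swap _ n n ⟩
        sumTo (λ m → sumTo (λ a → D f m * ((L ^ₛ m) a * D L (n ∸ a))) n) n
          ≈⟨ sumTo-cong (λ m → sym (*-sumToˡ _ _ n)) n ⟩
        R n ∎

    egf-compose : ∀ f n → egf (compose f) n ≈ sumTo (λ l → egf f l * egf ((ι (l !) ⁻¹) · (L ^ₛ l)) n) n
    egf-compose f n = sym (begin
      sumTo (λ l → (ι (l !) * f l) * (ι (n !) * (ι (l !) ⁻¹ * (L ^ₛ l) n))) n ≈⟨ sumTo-cong term n ⟩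
      sumTo (λ l → ι (n !) * (f l * (L ^ₛ l) n)) n                          ≈⟨ sym (*-sumToˡ _ _ n) ⟩
      ι (n !) * compose f n                                                 ∎)
      where
      term : ∀ l → (ι (l !) * f l) * (ι (n !) * (ι (l !) ⁻¹ * (L ^ₛ l) n)) ≈ ι (n !) * (f l * (L ^ₛ l) n)
      term l = begin
        (ι (l !) * f l) * (ι (n !) * (ι (l !) ⁻¹ * (L ^ₛ l) n))
          ≈⟨ solve 5 (λ a b c d e → (a :* b) :* (c :* (d :* e)) := c :* ((a :* d) :* (b :* e))) refl (ι (l !)) (f l) (ι (n !)) (ι (l !) ⁻¹) ((L ^ₛ l) n) ⟩
        ι (n !) * ((ι (l !) * ι (l !) ⁻¹) * (f l * (L ^ₛ l) n))
          ≈⟨ *-congˡ (trans (*-congʳ (⁻¹-inverse _ (ι[n!]≉0 l))) (*-identityˡ _)) ⟩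
        ι (n !) * (f l * (L ^ₛ l) n) ∎

  -- Substitution of the degenerate logarithm

  module _ (lam : Carrier) (lam≉0 : ¬ (lam ≈ 0#)) where

    λ⁻¹λ≈1 : lam ⁻¹ * lam ≈ 1#
    λ⁻¹λ≈1 = ⁻¹-inverseˡ lam lam≉0

    logλ-zero : logλ1+t lam zero ≈ 0#
    logλ-zero = trans (*-congˡ (trans (+-congʳ (binomial-zero 1# lam)) (-‿inverseʳ 1#))) (zeroʳ _)

    logλ-one : logλ1+t lam 1 ≈ 1#
    logλ-one = begin
      lam ⁻¹ * (onePlusPow 1# lam 1 - 0#)  ≈⟨ *-congˡ (trans (x-0≈x _) (binomial-one 1# lam)) ⟩
      lam ⁻¹ * (lam * 1#)                  ≈⟨ *-congˡ (*-identityʳ lam) ⟩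
      lam ⁻¹ * lam                         ≈⟨ λ⁻¹λ≈1 ⟩
      1#                                   ∎

    open Composition (logλ1+t lam) logλ-zero

    compose-affine : compose (affine lam) ≋ onePlusPow 1# lam
    compose-affine =
      compose (one ⊕ (lam · T))               ≋⟨ compose-⊕ one (lam · T) ⟩
      compose one ⊕ compose (lam · T)         ≋⟨ ⊕-cong compose-one (≋-trans (compose-· lam T) (·-cong refl compose-T)) ⟩
      one ⊕ (lam · logλ1+t lam)               ≋⟨ coeffwise cancel ⟩
      onePlusPow 1# lam                       ∎≋
      where
      cancel : ∀ n → one n + lam * (lam ⁻¹ * (onePlusPow 1# lam n - one n)) ≈ onePlusPow 1# lam n
      cancel n = begin
        one n + lam * (lam ⁻¹ * (R - one n))  ≈⟨ +-congˡ (trans (sym (*-assoc _ _ _)) (*-congʳ (⁻¹-inverse lam lam≉0))) ⟩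
        one n + 1# * (R - one n)              ≈⟨ +-congˡ (*-identityˡ _) ⟩
        one n + (R - one n)                   ≈⟨ solve 2 (λ o r → o :+ (r :- o) := r) refl (one n) R ⟩
        R                                     ∎
        where R = onePlusPow 1# lam n

    D-logλ : D (logλ1+t lam) ≋ (lam ⁻¹) · D (onePlusPow 1# lam)
    D-logλ =
      D ((lam ⁻¹) · (onePlusPow 1# lam ⊖ one))   ≋⟨ D-· (lam ⁻¹) (onePlusPow 1# lam ⊖ one) ⟩
      (lam ⁻¹) · D (onePlusPow 1# lam ⊖ one)     ≋⟨ ·-cong refl (≋-trans (D-⊖ (onePlusPow 1# lam) one) (coeffwise λ n → trans (+-congˡ (trans (-‿cong (D-one n)) -0#≈0#)) (+-identityʳ _))) ⟩
      (lam ⁻¹) · D (onePlusPow 1# lam)           ∎≋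

    -- Both sides solve (1 + t) g′ = aλ g with g(0) = 1: for the left side by the chain rule,
    -- since (1 + t) (log_λ(1 + t))′ = (1 + t)^λ = 1 + λ log_λ(1 + t).
    compose-binomial : ∀ a → compose (onePlusPow lam a) ≋ onePlusPow 1# (a * lam)
    compose-binomial a = recurrence-unique (ODE⇒recurrence ode) (binomial-recurrence 1# (a * lam)) g₀≈1
      where
      g  = compose (onePlusPow lam a)
      P′ = D (onePlusPow lam a)
      R  = onePlusPow 1# lam

      g₀≈1 : g zero ≈ onePlusPow 1# (a * lam) zero
      g₀≈1 = trans (*-identityʳ _) (trans (binomial-zero lam a) (sym (binomial-zero 1# (a * lam))))

      ode : LinearODE 1# ((a * lam) * 1#) g
      ode =
        affine 1# ⊛ D g                              ≋⟨ ⊛-congˡ (affine 1#) (≋-trans (chain-rule (onePlusPow lam a)) (⊛-congˡ (compose P′) D-logλ)) ⟩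
        affine 1# ⊛ (compose P′ ⊛ ((lam ⁻¹) · D R))  ≋⟨ ⊛-congˡ (affine 1#) (⊛-·ʳ (lam ⁻¹) (compose P′) (D R)) ⟩
        affine 1# ⊛ ((lam ⁻¹) · (compose P′ ⊛ D R))  ≋⟨ ⊛-·ʳ (lam ⁻¹) (affine 1#) (compose P′ ⊛ D R) ⟩
        (lam ⁻¹) · (affine 1# ⊛ (compose P′ ⊛ D R))  ≋⟨ ·-cong refl (⊛-swap (affine 1#) (compose P′) (D R)) ⟩
        (lam ⁻¹) · (compose P′ ⊛ (affine 1# ⊛ D R))  ≋⟨ ·-cong refl (⊛-congˡ (compose P′) (binomial-ODE 1# lam)) ⟩
        (lam ⁻¹) · (compose P′ ⊛ ((lam * 1#) · R))   ≋⟨ ·-cong refl (⊛-·ʳ (lam * 1#) (compose P′) R) ⟩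
        (lam ⁻¹) · ((lam * 1#) · (compose P′ ⊛ R))   ≋⟨ coeffwise (λ n → trans (sym (*-assoc _ _ _)) (trans (*-congʳ (trans (*-congˡ (*-identityʳ lam)) λ⁻¹λ≈1)) (*-identityˡ _))) ⟩
        compose P′ ⊛ R                               ≋⟨ ≋-trans (⊛-congˡ (compose P′) (≋-sym compose-affine)) (≋-sym (compose-⊛ P′ (affine lam))) ⟩
        compose (P′ ⊛ affine lam)                    ≋⟨ compose-cong (≋-trans (⊛-comm P′ (affine lam)) (binomial-ODE lam a)) ⟩
        compose ((a * lam) · onePlusPow lam a)       ≋⟨ compose-· (a * lam) (onePlusPow lam a) ⟩
        (a * lam) · g                                ≋⟨ ·-cong (sym (*-identityʳ _)) ≋-refl ⟩
        ((a * lam) * 1#) · g                         ∎≋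

    binomial-one-one : onePlusPow 1# 1# ≋ 1+t
    binomial-one-one = recurrence-unique (binomial-recurrence 1# 1#) rec (trans (binomial-zero 1# 1#) (sym (+-identityʳ 1#)))
      where
      1-ι1≈0 : 1# * 1# - 1# * ι 1 ≈ 0#
      1-ι1≈0 = trans (+-cong (*-identityˡ 1#) (-‿cong (trans (*-identityˡ _) ι1≈1))) (-‿inverseʳ 1#)

      rec : LinearRecurrence 1# (1# * 1#) 1+t
      rec zero = begin
        ι 1 * (0# + 1#)                ≈⟨ *-cong ι1≈1 (+-identityˡ 1#) ⟩
        1# * 1#                        ≈⟨ sym (trans (*-cong (a-b*ι0≈a (1# * 1#) 1#) (+-identityʳ 1#)) (*-identityʳ _)) ⟩
        (1# * 1# - 1# * ι 0) * (1# + 0#) ∎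
      rec (suc zero)    = trans (*-congˡ (+-identityʳ 0#)) (trans (zeroʳ _) (sym (trans (*-congʳ 1-ι1≈0) (zeroˡ _))))
      rec (suc (suc m)) = trans (*-congˡ (+-identityʳ 0#)) (trans (zeroʳ _) (sym (trans (*-congˡ (+-identityʳ 0#)) (zeroʳ _))))

    [1·λ⁻¹]λ≈1 : (1# * lam ⁻¹) * lam ≈ 1#
    [1·λ⁻¹]λ≈1 = trans (*-congʳ (*-identityˡ _)) λ⁻¹λ≈1

    [-λ⁻¹]λ≈-1 : (- lam ⁻¹) * lam ≈ - 1#
    [-λ⁻¹]λ≈-1 = trans (sym (-‿distribˡ-* _ _)) (-‿cong λ⁻¹λ≈1)

    eλ-difference : Series
    eλ-difference = eλ lam ⊖ eλinv lam

    [1+t]-difference : Series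
    [1+t]-difference = 1+t ⊖ onePlusPow 1# (- 1#)

    compose-eλ-difference : compose eλ-difference ≋ [1+t]-difference
    compose-eλ-difference =
      compose eλ-difference
        ≋⟨ compose-⊖ (eλ lam) (eλinv lam) ⟩
      compose (eλ lam) ⊖ compose (eλinv lam)
        ≋⟨ ⊖-cong (≋-trans (compose-binomial (1# * lam ⁻¹)) (binomial-cong 1# [1·λ⁻¹]λ≈1))
                  (≋-trans (compose-binomial (- lam ⁻¹)) (binomial-cong 1# [-λ⁻¹]λ≈-1)) ⟩
      onePlusPow 1# 1# ⊖ onePlusPow 1# (- 1#)
        ≋⟨ ⊖-cong binomial-one-one ≋-refl ⟩
      [1+t]-difference ∎≋

    eλ-difference-zero : eλ-difference zero ≈ 0#
    eλ-difference-zero = trans (+-cong (binomial-zero lam (1# * lam ⁻¹)) (-‿cong (binomial-zero lam (- lam ⁻¹)))) (-‿inverseʳ 1#)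

    eλ-difference-one : eλ-difference 1 ≈ ι 2
    eλ-difference-one = begin
      onePlusPow lam (1# * lam ⁻¹) 1 - onePlusPow lam (- lam ⁻¹) 1 ≈⟨ +-cong (binomial-one lam (1# * lam ⁻¹)) (-‿cong (binomial-one lam (- lam ⁻¹))) ⟩
      (1# * lam ⁻¹) * lam - (- lam ⁻¹) * lam                       ≈⟨ +-cong [1·λ⁻¹]λ≈1 (-‿cong [-λ⁻¹]λ≈-1) ⟩
      1# - - 1#                                                    ≈⟨ +-congˡ (-‿involutive 1#) ⟩
      1# + 1#                                                      ≈⟨ +-congˡ (sym ι1≈1) ⟩
      ι 2                                                          ∎

    [1+t]-difference-zero : [1+t]-difference zero ≈ 0#
    [1+t]-difference-zero = trans (+-cong (+-identityʳ 1#) (-‿cong (binomial-zero 1# (- 1#)))) (-‿inverseʳ 1#)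

    [1+t]-difference÷logλ : [1+t]-difference ÷ logλ1+t lam ≋ compose (shift eλ-difference)
    [1+t]-difference÷logλ = ÷-unique [1+t]-difference L (compose (shift eλ-difference)) logλ-one≉0 (T⊛-cancel (
      T ⊛ (shift L ⊛ compose (shift eλ-difference))   ≋⟨ ≋-sym (⊛-assoc T (shift L) (compose (shift eλ-difference))) ⟩
      (T ⊛ shift L) ⊛ compose (shift eλ-difference)   ≋⟨ ⊛-congʳ (compose (shift eλ-difference)) (≋-trans (T⊛shift L logλ-zero) (≋-sym compose-T)) ⟩
      compose T ⊛ compose (shift eλ-difference)       ≋⟨ ≋-sym (compose-⊛ T (shift eλ-difference)) ⟩
      compose (T ⊛ shift eλ-difference)               ≋⟨ compose-cong (T⊛shift eλ-difference eλ-difference-zero) ⟩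
      compose eλ-difference                           ≋⟨ compose-eλ-difference ⟩
      [1+t]-difference                                ≋⟨ ≋-sym (T⊛shift [1+t]-difference [1+t]-difference-zero) ⟩
      T ⊛ shift [1+t]-difference                      ∎≋))
      where
      L = logλ1+t lam
      logλ-one≉0 : ¬ (L 1 ≈ 0#)
      logλ-one≉0 L₁≈0 = 0≉1 (trans (sym L₁≈0) logλ-one)

    βStarSeries-negative : ∀ k x → βStarSeries lam (negℤ (+ k)) x ≋ (shift eλ-difference ^ₛ k) ⊛ eλ^ lam x
    βStarSeries-negative zero    x = ≋-refl
    βStarSeries-negative (suc k) x = ⊛-congʳ (eλ^ lam x) (^ₛ-cong (inv-T÷ eλ-difference eλ-difference-one≉0) (suc k))
      where
      eλ-difference-one≉0 : ¬ (eλ-difference 1 ≈ 0#)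
      eλ-difference-one≉0 = charZero 1 ∘ trans (sym eλ-difference-one)

    compose-βStarSeries : ∀ k x → compose (βStarSeries lam (negℤ (+ k)) x) ≋ bStarSeries lam k x
    compose-βStarSeries k x =
      compose (βStarSeries lam (negℤ (+ k)) x)                     ≋⟨ compose-cong (βStarSeries-negative k x) ⟩
      compose ((shift eλ-difference ^ₛ k) ⊛ eλ^ lam x)             ≋⟨ compose-⊛ (shift eλ-difference ^ₛ k) (eλ^ lam x) ⟩
      compose (shift eλ-difference ^ₛ k) ⊛ compose (eλ^ lam x)     ≋⟨ ⊛-cong (compose-^ₛ (shift eλ-difference) k) (compose-binomial (x * lam ⁻¹)) ⟩
      (compose (shift eλ-difference) ^ₛ k) ⊛ onePlusPow 1# ((x * lam ⁻¹) * lam)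
        ≋⟨ ⊛-cong (^ₛ-cong (≋-sym [1+t]-difference÷logλ) k) (binomial-cong 1# [xλ⁻¹]λ≈x) ⟩
      bStarSeries lam k x                                          ∎≋
      where
      [xλ⁻¹]λ≈x : (x * lam ⁻¹) * lam ≈ x
      [xλ⁻¹]λ≈x = trans (*-assoc _ _ _) (trans (*-congˡ λ⁻¹λ≈1) (*-identityʳ x))

    bStar≈Σ[βStar*S1] : ∀ k x n → bStar lam k x n ≈ sumTo (λ l → βStar lam (negℤ (+ k)) x l * S1 lam n l) n
    bStar≈Σ[βStar*S1] k x n =
      trans (*-congˡ (sym (coeff (compose-βStarSeries k x) n))) (egf-compose (βStarSeries lam (negℤ (+ k)) x) n)

-- The identity holds for k = 0 as well.
theorem3 : ∀ {c ℓ : Level} (F : CharZeroField c ℓ) →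
    let open CharZeroField F
        open FPS F
    in (lam : Carrier) → ¬ (lam ≈ 0#) → (k : ℕ) → 1 ≤ k → (x : Carrier) → (n : ℕ) →
      bStar lam k x n ≈ sumTo (λ l → βStar lam (negℤ (+ k)) x l * S1 lam n l) n
theorem3 F lam lam≉0 k _ = bStar≈Σ[βStar*S1] F lam lam≉0 k
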